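{- Let $n\ge 1$ and let $G_n=(V_n,E_n)$ be the graph whose vertices are the vectors $v\in\mathbb{R}^n$ with all coordinates in $\{ -1,0,1\}$ and $|v|=\sqrt3$, two vertices $u,v$ being adjacent iff $\langle u,v\rangle=1$. Let $A$ be an independent set of maximum size in $G_n$. Suppose $k$ signplaces are excluded, i.e. we remove from $G_n$ these $k$ signplaces together with all vertices intersecting any of them, and let $A'$ be the set of vertices of $A$ that remain. Assume that the number of vertices of $A$ removed in this way is at most $2k$. Then either $a(A')\ge 5$ or $m(A')<14$.
   Context: A signplace is a pair $(x,s)$ consisting of a coordinate index $x\in\{1,\dots,n\}$ and a sign $s\in\{+,-\}$, written $x^+$ or $x^-$; there are $2n$ signplaces. A vertex $v$ intersects the signplace $x^+$ (resp. $x^-$) if $v_x=+1$ (resp. $v_x=-1$). The degree of a signplace in a set $W$ of vertices is the number of vertices of $W$ intersecting it. $a(A')$ denotes the maximum degree of a signplace in $A'$, and $m(A')$ denotes the number of signplaces that were not excluded, i.e. $m(A')=2n-k$. -}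

module Defs where

open import Data.Nat using (ℕ; zero; suc; _+_; _*_; _∸_; _⊔_; _≤_; _<_)
open import Data.Integer as ℤ using (ℤ; +_; -[1+_])
open import Data.Fin using (Fin)
open import Data.Vec using (Vec; lookup; zipWith; foldr)
open import Data.List as L using (List; []; _∷_; length; map; allFin; concatMap)
open import Data.List.Membership.Propositional using (_∈_)
open import Data.List.Relation.Unary.Unique.Propositional using (Unique)
open import Data.Bool using (Bool; true; false; if_then_else_; not; _∨_)
open import Data.Product using (_×_; _,_)
open import Relation.Binary.PropositionalEquality using (_≡_)
open import Relation.Nullary using (¬_)

data Trit : Set where
  neg zer pos : Trit

toℤ : Trit → ℤ
toℤ neg = -[1+ 0 ]
toℤ zer = + 0
toℤ pos = + 1

Pt : ℕ → Set
Pt n = Vec Trit n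

inner : ∀ {n} → Pt n → Pt n → ℤ
inner u v = foldr (λ _ → ℤ) ℤ._+_ (+ 0) (zipWith (λ a b → toℤ a ℤ.* toℤ b) u v)

IsVertex : ∀ {n} → Pt n → Set
IsVertex v = inner v v ≡ + 3

IsVertexSet : ∀ {n} → List (Pt n) → Set
IsVertexSet W = (∀ {v} → v ∈ W → IsVertex v) × Unique W

Independent : ∀ {n} → List (Pt n) → Set
Independent W = ∀ {u v} → u ∈ W → v ∈ W → ¬ (inner u v ≡ + 1)

MaxIndependent : ∀ {n} → List (Pt n) → Set
MaxIndependent {n} A =
  IsVertexSet A × Independent A ×
  (∀ (B : List (Pt n)) → IsVertexSet B → Independent B → length B ≤ length A)

data Sgn : Set where
  plus minus : Sgn

Signplace : ℕ → Set
Signplace n = Fin n × Sgn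

allSignplaces : ∀ n → List (Signplace n)
allSignplaces n = concatMap (λ x → (x , plus) ∷ (x , minus) ∷ []) (allFin n)

intersects : ∀ {n} → Pt n → Signplace n → Bool
intersects v (x , plus) with lookup v x
... | pos = true
... | _   = false
intersects v (x , minus) with lookup v x
... | neg = true
... | _   = false

hitsAny : ∀ {n} → List (Signplace n) → Pt n → Bool
hitsAny [] v = false
hitsAny (p ∷ K) v = intersects v p ∨ hitsAny K v

filterB : ∀ {A : Set} → (A → Bool) → List A → List A
filterB f [] = []
filterB f (x ∷ xs) = if f x then x ∷ filterB f xs else filterB f xs

removed : ∀ {n} → List (Signplace n) → List (Pt n) → List (Pt n)
removed K W = filterB (hitsAny K) W

remaining : ∀ {n} → List (Signplace n) → List (Pt n) → List (Pt n)
remaining K W = filterB (λ v → not (hitsAny K v)) W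

degree : ∀ {n} → Signplace n → List (Pt n) → ℕ
degree p W = length (filterB (λ v → intersects v p) W)

a : ∀ {n} → List (Pt n) → ℕ
a {n} W = L.foldr _⊔_ 0 (map (λ p → degree p W) (allSignplaces n))

-- m(A') = 2n - k, where k = |K| is the number of excluded signplaces
m : ∀ {n} → List (Signplace n) → ℕ
m {n} K = 2 * n ∸ length K

-- Blocks of four coordinates carry the 16 vectors of weight 3 with an even number of minus
-- signs, which are pairwise non-adjacent; together with one 3-coordinate block of 4 vectors
-- this gives an independent set of size at least 4n - 8, hence |A| >= 4n - 8. Every vertex
-- meets exactly 3 signplaces and the vertices of A' meet only the m = 2n - k surviving ones,
-- so double counting gives 3|A'| <= a(A') m. If a(A') <= 4, then
-- 4n - 8 <= |A| <= 2k + |A'| <= 2k + 4m/3, which forces m <= 12.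
module Submission where

open import Defs
open import Data.Nat using (ℕ; _*_; _≤_; _<_)
open import Data.List using (List; length)
open import Data.List.Relation.Unary.Unique.Propositional using (Unique)
open import Data.Sum using (_⊎_)

open import Algebra.Properties.CommutativeSemigroup using (interchange)
open import Data.Bool using (Bool; true; false; not)
open import Data.Bool.Properties using (∨-zeroʳ)
open import Data.Empty using (⊥-elim)
open import Data.Fin as Fin using (Fin)
import Data.Integer as ℤ
import Data.Integer.Properties as ℤ
open import Data.List using ([]; _∷_; [_]; _++_; map; foldr; allFin; concatMap; tabulate)
open import Data.List.Membership.Propositional using (_∈_)
open import Data.List.Membership.Propositional.Properties
  using (∈-++⁺ˡ; ∈-++⁺ʳ; ∈-++⁻; ∈-map⁺; ∈-map⁻; ∈-∃++; ∈-allFin; ∈-concatMap⁺)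
open import Data.List.Properties using (length-++; length-map; length-tabulate; map-cong; map-tabulate; foldr-preservesᵒ)
open import Data.List.Relation.Binary.Subset.Propositional using (_⊆_)
open import Data.List.Relation.Unary.All as All using (All; all?)
open import Data.List.Relation.Unary.AllPairs as AllPairs using (allPairs?)
open import Data.List.Relation.Unary.Any as Any using (here; there)
import Data.List.Relation.Unary.Unique.Propositional.Properties as Unique
open import Data.Nat using (suc; _+_; _∸_; _⊔_; z≤n; s≤s; _≤?_)
open import Data.Nat.ListAction using (sum)
open import Data.Nat.Properties
open import Data.Product using (_×_; _,_; ∃)
open import Data.Product.Properties using (≡-dec)
open import Data.Sum as Sum using (inj₁; inj₂)
open import Data.Vec as Vec using ([]; _∷_; lookup; replicate; insertAt)
import Data.Vec.Properties as Vec
open import Function using (_∘_; case_of_)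
open import Relation.Binary.Definitions using (DecidableEquality)
open import Relation.Binary.PropositionalEquality hiding ([_])
open import Relation.Nullary using (¬_; Dec; yes; no; does; ¬?)
open import Relation.Nullary.Decidable using (toWitness; dec-true; _×-dec_)
open import Relation.Unary using (Decidable)

count : ∀ {A : Set} → (A → Bool) → List A → ℕ
count f xs = length (filterB f xs)

module _ {A : Set} where

  count-++ : (f : A → Bool) (xs ys : List A) → count f (xs ++ ys) ≡ count f xs + count f ys
  count-++ f []       ys = refl
  count-++ f (x ∷ xs) ys with f x
  ... | true  = cong suc (count-++ f xs ys)
  ... | false = count-++ f xs ys

  count+count-not : (f : A → Bool) (xs : List A) →
    count f xs + count (not ∘ f) xs ≡ length xs
  count+count-not f []       = refl
  count+count-not f (x ∷ xs) with f x
  ... | true  = cong suc (count+count-not f xs)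
  ... | false = trans (+-suc _ _) (cong suc (count+count-not f xs))

  ∈-filterB⁻ : (f : A → Bool) (xs : List A) {x : A} → x ∈ filterB f xs → x ∈ xs
  ∈-filterB⁻ f (y ∷ xs) p with f y
  ∈-filterB⁻ f (y ∷ xs) (here e)  | true = here e
  ∈-filterB⁻ f (y ∷ xs) (there p) | true = there (∈-filterB⁻ f xs p)
  ∈-filterB⁻ f (y ∷ xs) p         | false = there (∈-filterB⁻ f xs p)

  ∈-filterB⁺ : (f : A → Bool) (xs : List A) {x : A} → x ∈ xs → f x ≡ true → x ∈ filterB f xs
  ∈-filterB⁺ f (y ∷ xs) (here refl) fx rewrite fx = here refl
  ∈-filterB⁺ f (y ∷ xs) (there p)   fx with f y
  ... | true  = there (∈-filterB⁺ f xs p fx)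
  ... | false = ∈-filterB⁺ f xs p fx

  count-filterB-not≡0 : (f g : A → Bool) → (∀ x → f x ≡ true → g x ≡ true) →
    (xs : List A) → count f (filterB (not ∘ g) xs) ≡ 0
  count-filterB-not≡0 f g f⇒g []       = refl
  count-filterB-not≡0 f g f⇒g (x ∷ xs) with g x in gx
  ... | true  = count-filterB-not≡0 f g f⇒g xs
  ... | false with f x in fx
  ...   | true  with () ← trans (sym gx) (f⇒g x fx)
  ...   | false = count-filterB-not≡0 f g f⇒g xs

  Unique-⊆⇒length≤ : {xs ys : List A} → Unique xs → xs ⊆ ys → length xs ≤ length ys
  Unique-⊆⇒length≤ {[]}     _             _    = z≤n
  Unique-⊆⇒length≤ {x ∷ xs} (x∉xs AllPairs.∷ u) x∷xs⊆ys with ∈-∃++ (x∷xs⊆ys (here refl))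
  ... | us , vs , refl = begin
    suc (length xs)          ≤⟨ s≤s (Unique-⊆⇒length≤ u xs⊆us++vs) ⟩
    suc (length (us ++ vs))  ≡⟨ cong suc (length-++ us) ⟩
    suc (length us + length vs) ≡⟨ +-suc (length us) (length vs) ⟨
    length us + length (x ∷ vs) ≡⟨ length-++ us ⟨
    length (us ++ x ∷ vs)    ∎
    where
    open ≤-Reasoning
    xs⊆us++vs : xs ⊆ us ++ vs
    xs⊆us++vs y∈xs with ∈-++⁻ us (x∷xs⊆ys (there y∈xs))
    ... | inj₁ y∈us         = ∈-++⁺ˡ y∈us
    ... | inj₂ (here refl)  = ⊥-elim (All.lookup x∉xs y∈xs refl)
    ... | inj₂ (there y∈vs) = ∈-++⁺ʳ us y∈vs

  sum-map-+ : (f g : A → ℕ) (xs : List A) →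
    sum (map (λ x → f x + g x) xs) ≡ sum (map f xs) + sum (map g xs)
  sum-map-+ f g []       = refl
  sum-map-+ f g (x ∷ xs) = trans (cong ((f x + g x) +_) (sum-map-+ f g xs))
    (interchange +-commutativeSemigroup (f x) (g x) (sum (map f xs)) (sum (map g xs)))

  sum-map-const : (f : A → ℕ) (c : ℕ) (xs : List A) → (∀ {x} → x ∈ xs → f x ≡ c) →
    sum (map f xs) ≡ c * length xs
  sum-map-const f c []       _  = sym (*-zeroʳ c)
  sum-map-const f c (x ∷ xs) fc = trans (cong₂ _+_ (fc (here refl)) (sum-map-const f c xs (fc ∘ there)))
    (sym (*-suc c (length xs)))

  sum-map-≤-count : (f : A → ℕ) (g : A → Bool) (b : ℕ) → (∀ x → f x ≤ b) →
    (∀ x → g x ≡ true → f x ≡ 0) → (xs : List A) → sum (map f xs) ≤ b * count (not ∘ g) xs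
  sum-map-≤-count f g b f≤b g⇒0 []       = z≤n
  sum-map-≤-count f g b f≤b g⇒0 (x ∷ xs) with g x in gx
  ... | true  rewrite g⇒0 x gx = sum-map-≤-count f g b f≤b g⇒0 xs
  ... | false = ≤-trans (+-mono-≤ (f≤b x) (sum-map-≤-count f g b f≤b g⇒0 xs))
                        (≤-reflexive (sym (*-suc b _)))

double-count : ∀ {A B : Set} (R : A → B → Bool) (xs : List A) (ys : List B) →
  sum (map (λ y → count (λ x → R x y) xs) ys) ≡ sum (map (λ x → count (R x) ys) xs)
double-count R []       ys = sum-map-const (λ _ → 0) 0 ys (λ _ → refl)
double-count R (x ∷ xs) ys = begin
  sum (map (λ y → count (λ x′ → R x′ y) (x ∷ xs)) ys)
    ≡⟨ cong sum (map-cong (λ y → count-++ (λ x′ → R x′ y) [ x ] xs) ys) ⟩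
  sum (map (λ y → count (λ x′ → R x′ y) [ x ] + count (λ x′ → R x′ y) xs) ys)
    ≡⟨ sum-map-+ (λ y → count (λ x′ → R x′ y) [ x ]) (λ y → count (λ x′ → R x′ y) xs) ys ⟩
  sum (map (λ y → count (λ x′ → R x′ y) [ x ]) ys) + sum (map (λ y → count (λ x′ → R x′ y) xs) ys)
    ≡⟨ cong₂ _+_ (row ys) (double-count R xs ys) ⟩
  count (R x) ys + sum (map (λ x′ → count (R x′) ys) xs) ∎
  where
  open ≡-Reasoning
  row : ∀ ys → sum (map (λ y → count (λ x′ → R x′ y) [ x ]) ys) ≡ count (R x) ys
  row []       = refl
  row (y ∷ ys) with R x y
  ... | true  = cong suc (row ys)
  ... | false = row ys

∈⇒≤foldr-⊔ : ∀ {x xs} → x ∈ xs → x ≤ foldr _⊔_ 0 xs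
∈⇒≤foldr-⊔ {xs = xs} x∈xs = foldr-preservesᵒ
  (λ y z → Sum.[ m≤n⇒m≤n⊔o z , m≤n⇒m≤o⊔n y ]) 0 xs (inj₂ (Any.map ≤-reflexive x∈xs))

nonzero : Trit → ℕ
nonzero zer = 0
nonzero _   = 1

weight : ∀ {n} → Pt n → ℕ
weight []      = 0
weight (t ∷ v) = nonzero t + weight v

inner-self : ∀ {n} (v : Pt n) → inner v v ≡ ℤ.+ weight v
inner-self []      = refl
inner-self (t ∷ v) = trans (cong (λ z → toℤ t ℤ.* toℤ t ℤ.+ z) (inner-self v)) (square t)
  where
  square : ∀ t → toℤ t ℤ.* toℤ t ℤ.+ ℤ.+ weight v ≡ ℤ.+ (nonzero t + weight v)
  square neg = refl
  square zer = refl
  square pos = refl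

weight-vertex : ∀ {n} {v : Pt n} → IsVertex v → weight v ≡ 3
weight-vertex {v = v} isV = ℤ.+-injective (trans (sym (inner-self v)) isV)

signplacesAt : ∀ {n} → Fin n → List (Signplace n)
signplacesAt x = (x , plus) ∷ (x , minus) ∷ []

∈-allSignplaces : ∀ {n} (p : Signplace n) → p ∈ allSignplaces n
∈-allSignplaces {n} (x , s) = ∈-concatMap⁺ signplacesAt (Any.map (at s) (∈-allFin x))
  where
  at : ∀ s {y} → x ≡ y → (x , s) ∈ signplacesAt y
  at plus  refl = here refl
  at minus refl = there (here refl)

length-allSignplaces : ∀ n → length (allSignplaces n) ≡ 2 * n
length-allSignplaces n = trans (length-concatMap (allFin n)) (cong (2 *_) (length-tabulate {n = n} (λ x → x)))
  where
  length-concatMap : (xs : List (Fin n)) → length (concatMap signplacesAt xs) ≡ 2 * length xs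
  length-concatMap []       = refl
  length-concatMap (x ∷ xs) = trans (cong (2 +_) (length-concatMap xs)) (sym (*-suc 2 (length xs)))

count-intersects : ∀ {n} (v : Pt n) → count (intersects v) (allSignplaces n) ≡ weight v
count-intersects {n} v = begin
  count (intersects v) (concatMap signplacesAt (allFin n))  ≡⟨ by-coordinate (allFin n) ⟩
  sum (map (nonzero ∘ lookup v) (allFin n))                 ≡⟨ cong sum (map-tabulate (λ x → x) (nonzero ∘ lookup v)) ⟩
  sum (tabulate (nonzero ∘ lookup v))                       ≡⟨ sum-tabulate v ⟩
  weight v                                                  ∎
  where
  open ≡-Reasoning
  at : ∀ x → count (intersects v) (signplacesAt x) ≡ nonzero (lookup v x)
  at x with lookup v x
  ... | neg = refl
  ... | zer = refl
  ... | pos = refl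
  by-coordinate : ∀ xs → count (intersects v) (concatMap signplacesAt xs) ≡ sum (map (nonzero ∘ lookup v) xs)
  by-coordinate []       = refl
  by-coordinate (x ∷ xs) = trans (count-++ (intersects v) (signplacesAt x) (concatMap signplacesAt xs))
    (cong₂ _+_ (at x) (by-coordinate xs))
  sum-tabulate : ∀ {k} (u : Pt k) → sum (tabulate (nonzero ∘ lookup u)) ≡ weight u
  sum-tabulate []      = refl
  sum-tabulate (t ∷ u) = cong (nonzero t +_) (sum-tabulate u)

sum-degree : ∀ {n} (W : List (Pt n)) → (∀ {v} → v ∈ W → IsVertex v) →
  sum (map (λ p → degree p W) (allSignplaces n)) ≡ 3 * length W
sum-degree {n} W isV = trans (double-count intersects W (allSignplaces n))
  (sum-map-const (λ v → count (intersects v) (allSignplaces n)) 3 W three)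
  where
  three : ∀ {v} → v ∈ W → count (intersects v) (allSignplaces n) ≡ 3
  three {v} v∈W = trans (count-intersects v) (weight-vertex {v = v} (isV v∈W))

degree≤a : ∀ {n} (p : Signplace n) (W : List (Pt n)) → degree p W ≤ a W
degree≤a p W = ∈⇒≤foldr-⊔ (∈-map⁺ (λ q → degree q W) (∈-allSignplaces p))

_≟ₛ_ : ∀ {n} → DecidableEquality (Signplace n)
_≟ₛ_ = ≡-dec Fin._≟_ sgn≟
  where
  sgn≟ : DecidableEquality Sgn
  sgn≟ plus  plus  = yes refl
  sgn≟ plus  minus = no λ ()
  sgn≟ minus plus  = no λ ()
  sgn≟ minus minus = yes refl

excluded : ∀ {n} → List (Signplace n) → Signplace n → Bool
excluded K p = does (Any.any? (p ≟ₛ_) K)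

excluded⇒∈ : ∀ {n} {K : List (Signplace n)} {p} → excluded K p ≡ true → p ∈ K
excluded⇒∈ {K = K} {p} = from-does (Any.any? (p ≟ₛ_) K)
  where
  from-does : (d : Dec (p ∈ K)) → does d ≡ true → p ∈ K
  from-does (yes p∈K) _ = p∈K

∈⇒excluded : ∀ {n} {K : List (Signplace n)} {p} → p ∈ K → excluded K p ≡ true
∈⇒excluded {K = K} {p} = dec-true (Any.any? (p ≟ₛ_) K)

count-notExcluded≤m : ∀ {n} (K : List (Signplace n)) → Unique K →
  count (not ∘ excluded K) (allSignplaces n) ≤ m K
count-notExcluded≤m {n} K uniqueK = m+n≤o⇒m≤o∸n (count (not ∘ excluded K) P) (begin
  count (not ∘ excluded K) P + length K             ≤⟨ +-monoʳ-≤ _ K≤excluded ⟩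
  count (not ∘ excluded K) P + count (excluded K) P ≡⟨ +-comm _ (count (excluded K) P) ⟩
  count (excluded K) P + count (not ∘ excluded K) P ≡⟨ count+count-not (excluded K) P ⟩
  length P                                          ≡⟨ length-allSignplaces n ⟩
  2 * n                                             ∎)
  where
  open ≤-Reasoning
  P = allSignplaces n
  K≤excluded : length K ≤ count (excluded K) P
  K≤excluded = Unique-⊆⇒length≤ uniqueK (λ p∈K → ∈-filterB⁺ (excluded K) P (∈-allSignplaces _) (∈⇒excluded p∈K))

intersects⇒hitsAny : ∀ {n} {K : List (Signplace n)} {p} (v : Pt n) → p ∈ K →
  intersects v p ≡ true → hitsAny K v ≡ true
intersects⇒hitsAny {K = q ∷ K} v (here refl) e rewrite e = refl
intersects⇒hitsAny {K = q ∷ K} v (there p∈K) e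
  rewrite intersects⇒hitsAny v p∈K e = ∨-zeroʳ (intersects v q)

degree-remaining : ∀ {n} (K : List (Signplace n)) {p} → p ∈ K → (W : List (Pt n)) →
  degree p (remaining K W) ≡ 0
degree-remaining K {p} p∈K = count-filterB-not≡0 (λ v → intersects v p) (hitsAny K)
  (λ v → intersects⇒hitsAny v p∈K)

3*remaining≤a*m : ∀ {n} (K : List (Signplace n)) → Unique K → (W : List (Pt n)) →
  (∀ {v} → v ∈ W → IsVertex v) → 3 * length (remaining K W) ≤ a (remaining K W) * m K
3*remaining≤a*m {n} K uniqueK W isV = begin
  3 * length W′                                          ≡⟨ sum-degree W′ (isV ∘ ∈-filterB⁻ _ W) ⟨
  sum (map (λ p → degree p W′) (allSignplaces n))       ≤⟨ sum-map-≤-count (λ p → degree p W′) (excluded K) (a W′)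
                                                             (λ p → degree≤a p W′)
                                                             (λ p e → degree-remaining K (excluded⇒∈ e) W)
                                                             (allSignplaces n) ⟩
  a W′ * count (not ∘ excluded K) (allSignplaces n)     ≤⟨ *-monoʳ-≤ (a W′) (count-notExcluded≤m K uniqueK) ⟩
  a W′ * m K                                            ∎
  where
  open ≤-Reasoning
  W′ = remaining K W

zeros : (n : ℕ) → Pt n
zeros n = replicate n zer

inner-++ : ∀ {k l} (u v : Pt k) (u′ v′ : Pt l) →
  inner (u Vec.++ u′) (v Vec.++ v′) ≡ inner u v ℤ.+ inner u′ v′
inner-++ []      []      u′ v′ = sym (ℤ.+-identityˡ (inner u′ v′))
inner-++ (s ∷ u) (t ∷ v) u′ v′ =
  trans (cong (λ z → toℤ s ℤ.* toℤ t ℤ.+ z) (inner-++ u v u′ v′))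
        (sym (ℤ.+-assoc (toℤ s ℤ.* toℤ t) (inner u v) (inner u′ v′)))

inner-zerosˡ : ∀ {n} (v : Pt n) → inner (zeros n) v ≡ ℤ.+ 0
inner-zerosˡ []      = refl
inner-zerosˡ (t ∷ v) = cong₂ ℤ._+_ (ℤ.*-zeroˡ (toℤ t)) (inner-zerosˡ v)

inner-zerosʳ : ∀ {n} (v : Pt n) → inner v (zeros n) ≡ ℤ.+ 0
inner-zerosʳ []      = refl
inner-zerosʳ (t ∷ v) = cong₂ ℤ._+_ (ℤ.*-zeroʳ (toℤ t)) (inner-zerosʳ v)

¬IsVertex-zeros : ∀ n → ¬ IsVertex (zeros n)
¬IsVertex-zeros n isV with () ← trans (sym (inner-zerosˡ (zeros n))) isV

module _ {k l : ℕ} where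

  padʳ : Pt k → Pt (k + l)
  padʳ u = u Vec.++ zeros l

  padˡ : Pt l → Pt (k + l)
  padˡ v = zeros k Vec.++ v

  inner-padʳ : (u v : Pt k) → inner (padʳ u) (padʳ v) ≡ inner u v
  inner-padʳ u v = trans (inner-++ u v (zeros l) (zeros l))
    (trans (cong (ℤ._+_ (inner u v)) (inner-zerosˡ (zeros l))) (ℤ.+-identityʳ (inner u v)))

  inner-padˡ : (u v : Pt l) → inner (padˡ u) (padˡ v) ≡ inner u v
  inner-padˡ u v = trans (inner-++ (zeros k) (zeros k) u v)
    (trans (cong (ℤ._+ inner u v) (inner-zerosˡ (zeros k))) (ℤ.+-identityˡ (inner u v)))

  inner-padʳˡ : (u : Pt k) (v : Pt l) → inner (padʳ u) (padˡ v) ≡ ℤ.+ 0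
  inner-padʳˡ u v = trans (inner-++ u (zeros k) (zeros l) v)
    (cong₂ ℤ._+_ (inner-zerosʳ u) (inner-zerosˡ v))

  inner-padˡʳ : (u : Pt l) (v : Pt k) → inner (padˡ u) (padʳ v) ≡ ℤ.+ 0
  inner-padˡʳ u v = trans (inner-++ (zeros k) v u (zeros l))
    (cong₂ ℤ._+_ (inner-zerosˡ v) (inner-zerosʳ u))

  _⊕_ : List (Pt k) → List (Pt l) → List (Pt (k + l))
  W ⊕ W′ = map padʳ W ++ map padˡ W′

  length-⊕ : (W : List (Pt k)) (W′ : List (Pt l)) → length (W ⊕ W′) ≡ length W + length W′
  length-⊕ W W′ = trans (length-++ (map padʳ W)) (cong₂ _+_ (length-map padʳ W) (length-map padˡ W′))

  ∈-⊕⁻ : {W : List (Pt k)} {W′ : List (Pt l)} {v : Pt (k + l)} → v ∈ W ⊕ W′ →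
    (∃ λ u → u ∈ W × v ≡ padʳ u) ⊎ (∃ λ u → u ∈ W′ × v ≡ padˡ u)
  ∈-⊕⁻ {W} v∈ = Sum.map (∈-map⁻ padʳ) (∈-map⁻ padˡ) (∈-++⁻ (map padʳ W) v∈)

  ⊕-isVertexSet : {W : List (Pt k)} {W′ : List (Pt l)} →
    IsVertexSet W → IsVertexSet W′ → IsVertexSet (W ⊕ W′)
  ⊕-isVertexSet {W} {W′} (isV , uniqueW) (isV′ , uniqueW′) = isVertex , unique
    where
    isVertex : ∀ {v} → v ∈ W ⊕ W′ → IsVertex v
    isVertex v∈ with ∈-⊕⁻ v∈
    ... | inj₁ (u , u∈W , refl)  = trans (inner-padʳ u u) (isV u∈W)
    ... | inj₂ (u , u∈W′ , refl) = trans (inner-padˡ u u) (isV′ u∈W′)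
    disjoint : ∀ {v} → ¬ (v ∈ map padʳ W × v ∈ map padˡ W′)
    disjoint (p , q) with ∈-map⁻ padʳ p | ∈-map⁻ padˡ q
    ... | u , u∈W , refl | _ , _ , eq =
      ¬IsVertex-zeros k (subst IsVertex (Vec.++-injectiveˡ u (zeros k) eq) (isV u∈W))
    unique : Unique (W ⊕ W′)
    unique = Unique.++⁺ (Unique.map⁺ (Vec.++-injectiveˡ _ _) uniqueW)
                        (Unique.map⁺ (Vec.++-injectiveʳ (zeros k) (zeros k)) uniqueW′) disjoint

  ⊕-independent : {W : List (Pt k)} {W′ : List (Pt l)} →
    Independent W → Independent W′ → Independent (W ⊕ W′)
  ⊕-independent indW indW′ u∈ v∈ with ∈-⊕⁻ u∈ | ∈-⊕⁻ v∈
  ... | inj₁ (u , u∈W , refl)  | inj₁ (v , v∈W , refl)  = indW u∈W v∈W ∘ trans (sym (inner-padʳ u v))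
  ... | inj₂ (u , u∈W′ , refl) | inj₂ (v , v∈W′ , refl) = indW′ u∈W′ v∈W′ ∘ trans (sym (inner-padˡ u v))
  ... | inj₁ (u , _ , refl)    | inj₂ (v , _ , refl)    = λ e → case trans (sym (inner-padʳˡ u v)) e of λ ()
  ... | inj₂ (u , _ , refl)    | inj₁ (v , _ , refl)    = λ e → case trans (sym (inner-padˡʳ u v)) e of λ ()

_≟ₜ_ : DecidableEquality Trit
neg ≟ₜ neg = yes refl
neg ≟ₜ zer = no λ ()
neg ≟ₜ pos = no λ ()
zer ≟ₜ neg = no λ ()
zer ≟ₜ zer = yes refl
zer ≟ₜ pos = no λ ()
pos ≟ₜ neg = no λ ()
pos ≟ₜ zer = no λ ()
pos ≟ₜ pos = yes refl

-- A decidable reformulation of IsVertexSet W × Independent W.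
IndependentVertexSet : ∀ {n} → List (Pt n) → Set
IndependentVertexSet W =
  All IsVertex W × Unique W × All (λ u → All (λ v → ¬ inner u v ≡ ℤ.+ 1) W) W

independentVertexSet? : ∀ {n} → Decidable (IndependentVertexSet {n})
independentVertexSet? W =
  all? (λ v → inner v v ℤ.≟ ℤ.+ 3) W ×-dec
  allPairs? (λ u v → ¬? (Vec.≡-dec _≟ₜ_ u v)) W ×-dec
  all? (λ u → all? (λ v → ¬? (inner u v ℤ.≟ ℤ.+ 1)) W) W

-- The four sign patterns with an even number of minus signs: distinct ones differ in exactly two places.
block3 : List (Pt 3)
block3 = (pos ∷ pos ∷ pos ∷ []) ∷ (pos ∷ neg ∷ neg ∷ []) ∷ (neg ∷ pos ∷ neg ∷ []) ∷ (neg ∷ neg ∷ pos ∷ []) ∷ []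

-- Two points with different supports meet in two coordinates, so their inner product is even.
block4 : List (Pt 4)
block4 = concatMap (λ v → map (λ i → insertAt v i zer) (allFin 4)) block3

IndependentVertexSet-block3 : IndependentVertexSet block3
IndependentVertexSet-block3 = toWitness {a? = independentVertexSet? block3} _

IndependentVertexSet-block4 : IndependentVertexSet block4
IndependentVertexSet-block4 = toWitness {a? = independentVertexSet? block4} _

IndependentVertexSet⇒IsVertexSet : ∀ {n} {W : List (Pt n)} → IndependentVertexSet W → IsVertexSet W
IndependentVertexSet⇒IsVertexSet (isV , uniqueW , _) = All.lookup isV , uniqueW

IndependentVertexSet⇒Independent : ∀ {n} {W : List (Pt n)} → IndependentVertexSet W → Independent W
IndependentVertexSet⇒Independent (_ , _ , ind) u∈W v∈W = All.lookup (All.lookup ind u∈W) v∈W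

blockSet : (n : ℕ) → List (Pt n)
blockSet 0 = []
blockSet 1 = []
blockSet 2 = []
blockSet 3 = block3
blockSet (suc (suc (suc (suc n)))) = block4 ⊕ blockSet n

blockSet-isVertexSet : ∀ n → IsVertexSet (blockSet n)
blockSet-isVertexSet 0 = (λ ()) , AllPairs.[]
blockSet-isVertexSet 1 = (λ ()) , AllPairs.[]
blockSet-isVertexSet 2 = (λ ()) , AllPairs.[]
blockSet-isVertexSet 3 = IndependentVertexSet⇒IsVertexSet IndependentVertexSet-block3
blockSet-isVertexSet (suc (suc (suc (suc n)))) =
  ⊕-isVertexSet (IndependentVertexSet⇒IsVertexSet IndependentVertexSet-block4) (blockSet-isVertexSet n)

blockSet-independent : ∀ n → Independent (blockSet n)
blockSet-independent 0 ()
blockSet-independent 1 ()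
blockSet-independent 2 ()
blockSet-independent 3 = IndependentVertexSet⇒Independent IndependentVertexSet-block3
blockSet-independent (suc (suc (suc (suc n)))) =
  ⊕-independent (IndependentVertexSet⇒Independent IndependentVertexSet-block4) (blockSet-independent n)

4n≤blockSet+8 : ∀ n → 4 * n ≤ length (blockSet n) + 8
4n≤blockSet+8 0 = z≤n
4n≤blockSet+8 1 = m≤m+n 4 4
4n≤blockSet+8 2 = ≤-refl
4n≤blockSet+8 3 = ≤-refl
4n≤blockSet+8 (suc (suc (suc (suc n)))) = begin
  4 * (4 + n)                         ≡⟨ *-distribˡ-+ 4 4 n ⟩
  16 + 4 * n                          ≤⟨ +-monoʳ-≤ 16 (4n≤blockSet+8 n) ⟩
  16 + (length (blockSet n) + 8)      ≡⟨ +-assoc 16 (length (blockSet n)) 8 ⟨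
  16 + length (blockSet n) + 8        ≡⟨ cong (_+ 8) (length-⊕ block4 (blockSet n)) ⟨
  length (block4 ⊕ blockSet n) + 8    ∎
  where open ≤-Reasoning

4n≤maxIndependent+8 : ∀ n {A : List (Pt n)} → MaxIndependent A → 4 * n ≤ length A + 8
4n≤maxIndependent+8 n (_ , _ , maximal) = ≤-trans (4n≤blockSet+8 n)
  (+-monoˡ-≤ 8 (maximal (blockSet n) (blockSet-isVertexSet n) (blockSet-independent n)))

d≤12 : ∀ d r → 2 * d ≤ r + 8 → 3 * r ≤ 4 * d → d ≤ 12
d≤12 d r 2d≤r+8 3r≤4d = *-cancelˡ-≤ 2 (+-cancelˡ-≤ (4 * d) (2 * d) 24 (begin
  4 * d + 2 * d  ≡⟨ *-distribʳ-+ d 4 2 ⟨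
  6 * d          ≡⟨ *-assoc 3 2 d ⟩
  3 * (2 * d)    ≤⟨ *-monoʳ-≤ 3 2d≤r+8 ⟩
  3 * (r + 8)    ≡⟨ *-distribˡ-+ 3 r 8 ⟩
  3 * r + 24     ≤⟨ +-monoˡ-≤ 24 3r≤4d ⟩
  4 * d + 24     ∎))
  where open ≤-Reasoning

2n∸k≤12 : ∀ n k r → 4 * n ≤ 2 * k + r + 8 → 3 * r ≤ 4 * (2 * n ∸ k) → 2 * n ∸ k ≤ 12
2n∸k≤12 n k r 4n≤2k+r+8 = d≤12 (2 * n ∸ k) r (begin
  2 * (2 * n ∸ k)      ≡⟨ *-distribˡ-∸ 2 (2 * n) k ⟩
  2 * (2 * n) ∸ 2 * k  ≡⟨ cong (_∸ 2 * k) (*-assoc 2 2 n) ⟨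
  4 * n ∸ 2 * k        ≤⟨ m≤n+o⇒m∸n≤o (4 * n) (2 * k) (≤-trans 4n≤2k+r+8 (≤-reflexive (+-assoc (2 * k) r 8))) ⟩
  r + 8                ∎)
  where open ≤-Reasoning

lemma1 : (n : ℕ) → 1 ≤ n →
    (A : List (Pt n)) → MaxIndependent A →
    (K : List (Signplace n)) → Unique K →
    length (removed K A) ≤ 2 * length K →
    (5 ≤ a (remaining K A)) ⊎ (m K < 14)
lemma1 n _ A maxA@((isVertex , _) , _) K uniqueK removed≤2k with 5 ≤? a (remaining K A)
... | yes 5≤a = inj₁ 5≤a
... | no  5≰a = inj₂ (s≤s (≤-trans (2n∸k≤12 n (length K) (length A′) 4n≤2k+A′+8 3A′≤4m) (n≤1+n 12)))
  where
  A′ = remaining K A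
  4n≤2k+A′+8 : 4 * n ≤ 2 * length K + length A′ + 8
  4n≤2k+A′+8 = begin
    4 * n                                  ≤⟨ 4n≤maxIndependent+8 n maxA ⟩
    length A + 8                           ≡⟨ cong (_+ 8) (count+count-not (hitsAny K) A) ⟨
    length (removed K A) + length A′ + 8   ≤⟨ +-monoˡ-≤ 8 (+-monoˡ-≤ (length A′) removed≤2k) ⟩
    2 * length K + length A′ + 8           ∎
    where open ≤-Reasoning
  3A′≤4m : 3 * length A′ ≤ 4 * m K
  3A′≤4m = ≤-trans (3*remaining≤a*m K uniqueK A isVertex) (*-monoˡ-≤ (m K) (≤-pred (≰⇒> 5≰a)))
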